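{- If $G$ is a graph with $\delta=\delta(G)\ge 1$ and $\Delta=\Delta(G)\ge 4\lceil\delta/2\rceil-3$, then $$\mathrm{DC}(G)\le \Big\lceil\frac{\delta}{2}\Big\rceil\Big(\Delta-2\Big\lceil\frac{\delta}{2}\Big\rceil+2\Big)+1+\Big\lfloor\frac{\delta}{2}\Big\rfloor.$$ Moreover, the bound is sharp and is attained for any odd minimum degree: for every odd $\delta\ge 3$ there exists a graph $G$ with $\delta(G)=\delta$ and $\Delta(G)\ge 4\lceil\delta/2\rceil-3$ attaining equality.
   Context: All graphs are finite, simple and connected; $\delta(G)$ and $\Delta(G)$ denote minimum and maximum degree. For a vertex $v$, $N[v]=N(v)\cup\{v\}$ denotes its closed neighborhood. For a graph with $\delta(G)\ge 1$, a set $S\subseteq V(G)$ is a double dominating set if $|N[v]\cap S|\ge 2$ for every $v\in V(G)$. Two disjoint sets $U,W\subseteq V(G)$ form a double coalition if neither is a double dominating set but $U\cup W$ is. A double coalition partition of $G$ is a partition $\Omega$ of $V(G)$ such that every set of $\Omega$ forms a double coalition with some other set of $\Omega$. The double coalition number $\mathrm{DC}(G)$ is the maximum cardinality of a double coalition partition of $G$. -}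

module Defs where

open import Data.Nat using (ℕ; zero; suc; _+_; _*_; _∸_; _≤_; ⌈_/2⌉; ⌊_/2⌋)
open import Data.Nat.Divisibility using (_∣_)
open import Data.Bool using (Bool; true; false; _∧_; _∨_; if_then_else_)
open import Data.Fin using (Fin; zero; suc; _≟_)
open import Data.Product using (Σ; ∃; _×_; _,_)
open import Relation.Nullary using (¬_)
open import Relation.Nullary.Decidable using (⌊_⌋)
open import Relation.Binary.PropositionalEquality using (_≡_; _≢_)

count : {n : ℕ} → (Fin n → Bool) → ℕ
count {zero}  P = 0
count {suc n} P = (if P zero then 1 else 0) + count (λ i → P (suc i))

data Reachable {n : ℕ} (adj : Fin n → Fin n → Bool) : Fin n → Fin n → Set where
  here : ∀ {u} → Reachable adj u u
  step : ∀ {u w v} → adj u w ≡ true → Reachable adj w v → Reachable adj u v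

record Graph : Set where
  field
    n       : ℕ
    adj     : Fin n → Fin n → Bool
    sym     : ∀ u v → adj u v ≡ adj v u
    irrefl  : ∀ v → adj v v ≡ false
    connected : ∀ u v → Reachable adj u v
open Graph public

Vertex : Graph → Set
Vertex G = Fin (n G)

VSet : Graph → Set
VSet G = Vertex G → Bool

deg : (G : Graph) → Vertex G → ℕ
deg G v = count (adj G v)

MinDegree : Graph → ℕ → Set
MinDegree G d = (∀ v → d ≤ deg G v) × (∃ λ v → deg G v ≡ d)

MaxDegree : Graph → ℕ → Set
MaxDegree G d = (∀ v → deg G v ≤ d) × (∃ λ v → deg G v ≡ d)

closedNbr : (G : Graph) → Vertex G → VSet G
closedNbr G v u = ⌊ u ≟ v ⌋ ∨ adj G v u

nbrCount : (G : Graph) → VSet G → Vertex G → ℕ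
nbrCount G S v = count (λ u → closedNbr G v u ∧ S u)

IsDoubleDominating : (G : Graph) → VSet G → Set
IsDoubleDominating G S = ∀ v → 2 ≤ nbrCount G S v

_∪_ : {G : Graph} → VSet G → VSet G → VSet G
(U ∪ W) v = U v ∨ W v

Disjoint : {G : Graph} → VSet G → VSet G → Set
Disjoint U W = ∀ v → U v ∧ W v ≡ false

IsDoubleCoalition : (G : Graph) → VSet G → VSet G → Set
IsDoubleCoalition G U W =
  Disjoint {G} U W × ¬ IsDoubleDominating G U × ¬ IsDoubleDominating G W
  × IsDoubleDominating G (_∪_ {G} U W)

record Partition (G : Graph) (k : ℕ) : Set where
  field
    label    : Vertex G → Fin k
    nonempty : ∀ (i : Fin k) → ∃ λ v → label v ≡ i
open Partition public

part : {G : Graph} {k : ℕ} → Partition G k → Fin k → VSet G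
part Ω i v = ⌊ label Ω v ≟ i ⌋

IsDoubleCoalitionPartition : (G : Graph) (k : ℕ) → Partition G k → Set
IsDoubleCoalitionPartition G k Ω =
  ∀ (i : Fin k) → ∃ λ (j : Fin k) → i ≢ j × IsDoubleCoalition G (part Ω i) (part Ω j)

HasDCPartition : Graph → ℕ → Set
HasDCPartition G k = Σ (Partition G k) (IsDoubleCoalitionPartition G k)

IsDCNumber : Graph → ℕ → Set
IsDCNumber G k = HasDCPartition G k × (∀ k′ → HasDCPartition G k′ → k′ ≤ k)

dcBound : ℕ → ℕ → ℕ
dcBound δ Δ = ⌈ δ /2⌉ * (Δ + 2 ∸ 2 * ⌈ δ /2⌉) + 1 + ⌊ δ /2⌋

module Submission where

-- Fix a vertex v of minimum degree and call a class heavy, light or absent when it meets N[v] in at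
-- least two, exactly one or no vertices; counting N[v] gives 2·#heavy + #light ≤ δ + 1.  The partner
-- of an absent class is heavy.  Call a class a hub when it is the partner of p ≥ 1 absent classes (its
-- satellites), and group each absent class with its partner.  A hub V_j is not double dominating, so
-- |N[u] ∩ V_j| = e ≤ 1 for some u; each satellite of V_j then meets N[u] in at least 2 − e vertices,
-- so the group of V_j meets N[u] in at least e + (2 − e)p ≥ p + 1 vertices and, likewise, the group of
-- every other hub in at least two.  As the groups partition N[u], of size at most Δ + 1, every hub has
-- at most Δ + 2 − 2h satellites, h being the number of hubs, whence #absent ≤ h(Δ + 2 − 2h).  Since
-- h ≤ #heavy ≤ ⌈δ/2⌉, there are at most δ + 1 + h(Δ + 1 − 2h) classes, and x ↦ x(Δ + 1 − 2x) is
-- nondecreasing for 0 ≤ x ≤ ⌈δ/2⌉ because 4⌈δ/2⌉ ≤ Δ + 3.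

open import Defs
open import Data.Nat using (ℕ; zero; suc; _+_; _*_; _∸_; _≤_; _≡ᵇ_; _<ᵇ_; _≤?_; z≤n; s≤s; ⌈_/2⌉; ⌊_/2⌋)
open import Data.Nat.Properties as ℕ hiding (_≟_; suc-injective)
open import Data.Nat.Divisibility using (_∣_; divides; ∣-refl; ∣m∣n⇒∣m+n)
open import Algebra.Properties.Semiring.Sum +-*-semiring
  using (sum; sum-syntax; sum-cong-≗; sum-replicate-zero; sum-remove; ∑-distrib-+; ∑-comm; *-distribˡ-sum)
open import Data.Bool using (Bool; true; false; _∧_; _∨_; not; if_then_else_)
open import Data.Bool.Properties
  using (∧-distribˡ-∨; ∧-conicalˡ; ∧-conicalʳ; ∧-zeroʳ; ∨-zeroʳ; ∨-comm; ∧-inverseʳ; ∨-inverseʳ; ∧-comm)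
open import Data.Empty using (⊥-elim)
open import Data.Fin using (Fin; zero; suc; _≟_; punchIn; _↑ˡ_; _↑ʳ_; splitAt; remQuot; combine)
open import Data.Fin.Properties
  using ( punchIn-punchOut; punchInᵢ≢i; suc-injective; ¬∀⟶∃¬; splitAt-↑ˡ; splitAt-↑ʳ; splitAt⁻¹-↑ˡ; splitAt⁻¹-↑ʳ
        ; remQuot-combine; combine-remQuot; combine-injective; ↑ˡ-injective; ↑ʳ-injective)
open import Function using (_∘_)
open import Data.List using (_∷_; [])
open import Data.Nat.Tactic.RingSolver using (solve)
open import Data.Product using (Σ; ∃; _×_; _,_; proj₁; proj₂; uncurry; map₂)
open import Data.Sum using (_⊎_; inj₁; inj₂; [_,_]′)
open import Relation.Nullary using (¬_; yes; no)
open import Relation.Nullary.Decidable using (⌊_⌋)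
open import Relation.Binary.PropositionalEquality as ≡
  using (_≡_; _≢_; refl; cong; cong₂; subst; subst₂; module ≡-Reasoning)

-- Finite sums and counting

≟-refl : ∀ {n} (i : Fin n) → ⌊ i ≟ i ⌋ ≡ true
≟-refl i with i ≟ i
... | yes _   = refl
... | no i≢i  = ⊥-elim (i≢i refl)

≟-≢ : ∀ {n} {i j : Fin n} → i ≢ j → ⌊ i ≟ j ⌋ ≡ false
≟-≢ {i = i} {j} i≢j with i ≟ j
... | yes i≡j = ⊥-elim (i≢j i≡j)
... | no _    = refl

≟-sym : ∀ {n} (i j : Fin n) → ⌊ i ≟ j ⌋ ≡ ⌊ j ≟ i ⌋
≟-sym i j with i ≟ j | j ≟ i
... | yes _   | yes _   = refl
... | no _    | no _    = refl
... | yes i≡j | no j≢i  = ⊥-elim (j≢i (≡.sym i≡j))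
... | no i≢j  | yes j≡i = ⊥-elim (i≢j (≡.sym j≡i))

≟-true : ∀ {n} {i j : Fin n} → ⌊ i ≟ j ⌋ ≡ true → i ≡ j
≟-true {i = i} {j} _ with i ≟ j
... | yes i≡j = i≡j

∨-introˡ : ∀ {a} b → a ≡ true → a ∨ b ≡ true
∨-introˡ b refl = refl

∨-introʳ : ∀ a {b} → b ≡ true → a ∨ b ≡ true
∨-introʳ a refl = ∨-zeroʳ a

𝟙[_] : Bool → ℕ
𝟙[ b ] = if b then 1 else 0

𝟙-∧ : ∀ a b → 𝟙[ a ∧ b ] ≡ (if b then 𝟙[ a ] else 0)
𝟙-∧ false false = refl
𝟙-∧ false true  = refl
𝟙-∧ true  false = refl
𝟙-∧ true  true  = refl

sum-mono-≤ : ∀ {n} {f g : Fin n → ℕ} → (∀ i → f i ≤ g i) → sum f ≤ sum g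
sum-mono-≤ {zero}  f≤g = z≤n
sum-mono-≤ {suc n} f≤g = +-mono-≤ (f≤g zero) (sum-mono-≤ (λ i → f≤g (suc i)))

sum-zero : ∀ {n} {f : Fin n → ℕ} → (∀ i → f i ≡ 0) → sum f ≡ 0
sum-zero {n} f≡0 = ≡.trans (sum-cong-≗ f≡0) (sum-replicate-zero n)

sum-point : ∀ {n} {f : Fin n → ℕ} (j : Fin n) → (∀ i → i ≢ j → f i ≡ 0) → sum f ≡ f j
sum-point {suc n} {f} j f≡0 = begin
  sum f                      ≡⟨ sum-remove {i = j} f ⟩
  f j + sum (f ∘ punchIn j)  ≡⟨ cong (f j +_) (sum-zero (λ i → f≡0 _ (punchInᵢ≢i j i))) ⟩
  f j + 0                    ≡⟨ +-identityʳ (f j) ⟩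
  f j                        ∎
  where open ≡-Reasoning

sum-≥-point : ∀ {n} (f : Fin n → ℕ) (j : Fin n) → f j ≤ sum f
sum-≥-point {suc n} f j = subst (f j ≤_) (≡.sym (sum-remove {i = j} f)) (m≤m+n (f j) _)

sum-≥-pair : ∀ {n} (f : Fin n → ℕ) {i j : Fin n} → i ≢ j → f i + f j ≤ sum f
sum-≥-pair {suc n} f {i} {j} i≢j = subst (f i + f j ≤_) (≡.sym (sum-remove {i = i} f)) (+-monoʳ-≤ (f i) fj≤rest)
  where
  fj≤rest : f j ≤ sum (f ∘ punchIn i)
  fj≤rest = subst (λ x → f x ≤ sum (f ∘ punchIn i)) (punchIn-punchOut i≢j) (sum-≥-point (f ∘ punchIn i) _)

∑-δ : ∀ {n} (j : Fin n) (f : Fin n → ℕ) → ∑[ i < n ] (if ⌊ i ≟ j ⌋ then f i else 0) ≡ f j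
∑-δ j f = ≡.trans (sum-point j (λ i i≢j → cong (λ b → if b then f i else 0) (≟-≢ i≢j)))
                  (cong (λ b → if b then f j else 0) (≟-refl j))

∑-δ′ : ∀ {n} (j : Fin n) (f : Fin n → ℕ) → ∑[ i < n ] (if ⌊ j ≟ i ⌋ then f i else 0) ≡ f j
∑-δ′ j f = ≡.trans (sum-point j (λ i i≢j → cong (λ b → if b then f i else 0) (≟-≢ (i≢j ∘ ≡.sym))))
                   (cong (λ b → if b then f j else 0) (≟-refl j))

sum-split : ∀ {n} (f : Fin n → ℕ) (j : Fin n) → sum f ≡ f j + ∑[ i < n ] (if ⌊ i ≟ j ⌋ then 0 else f i)
sum-split {n} f j = begin
  sum f                                                       ≡⟨ sum-cong-≗ (λ i → split ⌊ i ≟ j ⌋ (f i)) ⟩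
  ∑[ i < n ] ((if ⌊ i ≟ j ⌋ then f i else 0) + (if ⌊ i ≟ j ⌋ then 0 else f i))
    ≡⟨ ∑-distrib-+ (λ i → if ⌊ i ≟ j ⌋ then f i else 0) (λ i → if ⌊ i ≟ j ⌋ then 0 else f i) ⟩
  ∑[ i < n ] (if ⌊ i ≟ j ⌋ then f i else 0) + ∑[ i < n ] (if ⌊ i ≟ j ⌋ then 0 else f i)
    ≡⟨ cong (_+ ∑[ i < n ] (if ⌊ i ≟ j ⌋ then 0 else f i)) (∑-δ j f) ⟩
  f j + ∑[ i < n ] (if ⌊ i ≟ j ⌋ then 0 else f i)          ∎
  where
  open ≡-Reasoning
  split : ∀ b x → x ≡ (if b then x else 0) + (if b then 0 else x)
  split true  x = ≡.sym (+-identityʳ x)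
  split false x = refl

∑-fibres : ∀ {k m} (γ : Fin k → Fin m) (f : Fin k → ℕ) →
  ∑[ j < m ] ∑[ i < k ] (if ⌊ γ i ≟ j ⌋ then f i else 0) ≡ sum f
∑-fibres γ f = ≡.trans (≡.sym (∑-comm (λ i j → if ⌊ γ i ≟ j ⌋ then f i else 0)))
                       (sum-cong-≗ (λ i → ∑-δ′ (γ i) (λ _ → f i)))

∑-guard : ∀ {n} g (f : Fin n → ℕ) → ∑[ i < n ] (if g then f i else 0) ≡ (if g then sum f else 0)
∑-guard     true  f = refl
∑-guard {n} false f = sum-zero {n} {λ _ → 0} (λ _ → refl)

count≡∑ : ∀ {n} (P : Fin n → Bool) → count P ≡ ∑[ i < n ] 𝟙[ P i ]
count≡∑ {zero}  P = refl
count≡∑ {suc n} P = cong (𝟙[ P zero ] +_) (count≡∑ (λ i → P (suc i)))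

count-cong : ∀ {n} {P Q : Fin n → Bool} → (∀ i → P i ≡ Q i) → count P ≡ count Q
count-cong {zero}  P≡Q = refl
count-cong {suc n} P≡Q = cong₂ _+_ (cong 𝟙[_] (P≡Q zero)) (count-cong (λ i → P≡Q (suc i)))

count-false : ∀ {n} {P : Fin n → Bool} → (∀ i → P i ≡ false) → count P ≡ 0
count-false {n} {P} P≡false = ≡.trans (count≡∑ P) (sum-zero (λ i → cong 𝟙[_] (P≡false i)))

count-true : ∀ n → count {n} (λ _ → true) ≡ n
count-true zero    = refl
count-true (suc n) = cong suc (count-true n)

count-const : ∀ {n} g → count {n} (λ _ → g) ≡ (if g then n else 0)
count-const {n} true  = count-true n
count-const {n} false = count-false {n} {λ _ → false} (λ _ → refl)

count-≟ : ∀ {n} (j : Fin n) → count (λ i → ⌊ i ≟ j ⌋) ≡ 1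
count-≟ j = ≡.trans (count≡∑ (λ i → ⌊ i ≟ j ⌋)) (∑-δ j (λ _ → 1))

count-∨ : ∀ {n} (P Q : Fin n → Bool) → (∀ i → P i ∧ Q i ≡ false) →
  count (λ i → P i ∨ Q i) ≡ count P + count Q
count-∨ {n} P Q disj = begin
  count (λ i → P i ∨ Q i)           ≡⟨ count≡∑ (λ i → P i ∨ Q i) ⟩
  ∑[ i < n ] 𝟙[ P i ∨ Q i ]         ≡⟨ sum-cong-≗ (λ i → 𝟙-∨ (P i) (Q i) (disj i)) ⟩
  ∑[ i < n ] (𝟙[ P i ] + 𝟙[ Q i ])  ≡⟨ ∑-distrib-+ (λ i → 𝟙[ P i ]) (λ i → 𝟙[ Q i ]) ⟩
  sum (λ i → 𝟙[ P i ]) + sum (λ i → 𝟙[ Q i ])  ≡⟨ cong₂ _+_ (count≡∑ P) (count≡∑ Q) ⟨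
  count P + count Q                 ∎
  where
  open ≡-Reasoning
  𝟙-∨ : ∀ a b → a ∧ b ≡ false → 𝟙[ a ∨ b ] ≡ 𝟙[ a ] + 𝟙[ b ]
  𝟙-∨ false b     _ = refl
  𝟙-∨ true  false _ = refl

count-≢ : ∀ {n} (j : Fin (suc n)) → count (λ i → not ⌊ i ≟ j ⌋) ≡ n
count-≢ {n} j = ℕ.suc-injective (begin
  suc (count (λ i → not (is-j i)))                ≡⟨ cong (_+ count (λ i → not (is-j i))) (count-≟ j) ⟨
  count is-j + count (λ i → not (is-j i))         ≡⟨ count-∨ is-j (λ i → not (is-j i)) (λ i → ∧-inverseʳ (is-j i)) ⟨
  count (λ i → is-j i ∨ not (is-j i))             ≡⟨ count-cong (λ i → ∨-inverseʳ (is-j i)) ⟩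
  count {suc n} (λ _ → true)                      ≡⟨ count-true (suc n) ⟩
  suc n                                           ∎)
  where
  open ≡-Reasoning
  is-j : Fin (suc n) → Bool
  is-j i = ⌊ i ≟ j ⌋

count-mono : ∀ {n} {P Q : Fin n → Bool} → (∀ i → P i ≡ true → Q i ≡ true) → count P ≤ count Q
count-mono {zero}  P⇒Q = z≤n
count-mono {suc n} {P} {Q} P⇒Q = +-mono-≤ (𝟙-mono (P zero) (Q zero) (P⇒Q zero)) (count-mono (λ i → P⇒Q (suc i)))
  where
  𝟙-mono : ∀ a b → (a ≡ true → b ≡ true) → 𝟙[ a ] ≤ 𝟙[ b ]
  𝟙-mono false b     _   = z≤n
  𝟙-mono true  false a⇒b with () ← a⇒b refl
  𝟙-mono true  true  _   = ≤-refl

count-≥2 : ∀ {n} (P : Fin n → Bool) {i j : Fin n} → P i ≡ true → P j ≡ true → i ≢ j → 2 ≤ count P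
count-≥2 P {i} {j} Pi Pj i≢j = subst₂ _≤_ (cong₂ _+_ (cong 𝟙[_] Pi) (cong 𝟙[_] Pj)) (≡.sym (count≡∑ P))
  (sum-≥-pair (λ x → 𝟙[ P x ]) i≢j)

count-≤1 : ∀ {n} (P : Fin n → Bool) → (∀ i j → P i ≡ true → P j ≡ true → i ≡ j) → count P ≤ 1
count-≤1 {zero}  P unique = z≤n
count-≤1 {suc n} P unique with P zero in P0
... | true  = ≤-reflexive (cong suc (count-false Psuc≡false))
  where
  Psuc≡false : ∀ i → P (suc i) ≡ false
  Psuc≡false i with P (suc i) in Pi
  ... | true  with () ← unique zero (suc i) P0 Pi
  ... | false = refl
... | false = count-≤1 (λ i → P (suc i)) (λ i j Pi Pj → suc-injective (unique (suc i) (suc j) Pi Pj))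

∑-count-fibres : ∀ {k m} (γ : Fin k → Fin m) (P : Fin k → Bool) →
  ∑[ j < m ] count (λ i → P i ∧ ⌊ γ i ≟ j ⌋) ≡ count P
∑-count-fibres {k} {m} γ P = begin
  ∑[ j < m ] count (λ i → P i ∧ ⌊ γ i ≟ j ⌋)
    ≡⟨ sum-cong-≗ (λ j → ≡.trans (count≡∑ (λ i → P i ∧ ⌊ γ i ≟ j ⌋)) (sum-cong-≗ (λ i → 𝟙-∧ (P i) ⌊ γ i ≟ j ⌋))) ⟩
  ∑[ j < m ] ∑[ i < k ] (if ⌊ γ i ≟ j ⌋ then 𝟙[ P i ] else 0)
    ≡⟨ ∑-fibres γ (λ i → 𝟙[ P i ]) ⟩
  ∑[ i < k ] 𝟙[ P i ]
    ≡⟨ count≡∑ P ⟨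
  count P ∎
  where open ≡-Reasoning

∑-if : ∀ {n} (P : Fin n → Bool) (x : ℕ) → ∑[ i < n ] (if P i then x else 0) ≡ x * count P
∑-if {n} P x = begin
  ∑[ i < n ] (if P i then x else 0)  ≡⟨ sum-cong-≗ (λ i → if-then-0≡*𝟙 (P i)) ⟩
  ∑[ i < n ] (x * 𝟙[ P i ])           ≡⟨ *-distribˡ-sum x (λ i → 𝟙[ P i ]) ⟨
  x * ∑[ i < n ] 𝟙[ P i ]             ≡⟨ cong (x *_) (count≡∑ P) ⟨
  x * count P                         ∎
  where
  open ≡-Reasoning
  if-then-0≡*𝟙 : ∀ b → (if b then x else 0) ≡ x * 𝟙[ b ]
  if-then-0≡*𝟙 true  = ≡.sym (*-identityʳ x)
  if-then-0≡*𝟙 false = ≡.sym (*-zeroʳ x)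

∑-const : ∀ n x → ∑[ i < n ] x ≡ x * n
∑-const n x = ≡.trans (∑-if {n} (λ _ → true) x) (cong (x *_) (count-true n))

count-guard : ∀ {n} g (P : Fin n → Bool) → count (λ i → g ∧ P i) ≡ (if g then count P else 0)
count-guard     true  P = refl
count-guard {n} false P = count-false {n} {λ _ → false} (λ _ → refl)

∑-count-guard : ∀ {n l} g (P : Fin n → Fin l → Bool) →
  ∑[ x < n ] count (λ y → g ∧ P x y) ≡ (if g then ∑[ x < n ] count (P x) else 0)
∑-count-guard g P = ≡.trans (sum-cong-≗ (λ x → count-guard g (P x))) (∑-guard g (λ x → count (P x)))

∑∑-count-guard : ∀ {n l o} g (P : Fin n → Fin l → Fin o → Bool) →
  ∑[ x < n ] ∑[ y < l ] count (λ z → g ∧ P x y z) ≡ (if g then ∑[ x < n ] ∑[ y < l ] count (P x y) else 0)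
∑∑-count-guard g P =
  ≡.trans (sum-cong-≗ (λ x → ∑-count-guard g (P x))) (∑-guard g (λ x → ∑[ y < _ ] count (P x y)))

count-↑ : ∀ a b (P : Fin (a + b) → Bool) → count P ≡ count (λ i → P (i ↑ˡ b)) + count (λ i → P (a ↑ʳ i))
count-↑ zero    b P = refl
count-↑ (suc a) b P = ≡.trans (cong (𝟙[ P zero ] +_) (count-↑ a b (λ i → P (suc i))))
                              (≡.sym (+-assoc 𝟙[ P zero ] _ _))

count-combine : ∀ a b (P : Fin (a * b) → Bool) → count P ≡ ∑[ i < a ] count (λ j → P (combine i j))
count-combine zero    b P = refl
count-combine (suc a) b P =
  ≡.trans (count-↑ b (a * b) P) (cong (count (λ j → P (j ↑ˡ (a * b))) +_) (count-combine a b (λ i → P (b ↑ʳ i))))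

closedNbr-size : (G : Graph) (z : Vertex G) → count (closedNbr G z) ≡ suc (deg G z)
closedNbr-size G z = begin
  count (λ u → ⌊ u ≟ z ⌋ ∨ adj G z u)          ≡⟨ count-∨ (λ u → ⌊ u ≟ z ⌋) (adj G z) self∉adj ⟩
  count (λ u → ⌊ u ≟ z ⌋) + deg G z            ≡⟨ cong (_+ deg G z) (count-≟ z) ⟩
  suc (deg G z)                                ∎
  where
  open ≡-Reasoning
  self∉adj : ∀ u → ⌊ u ≟ z ⌋ ∧ adj G z u ≡ false
  self∉adj u with u ≟ z
  ... | yes refl = irrefl G u
  ... | no _     = refl

closedNbr-cases : (G : Graph) {z x : Vertex G} → closedNbr G z x ≡ true → x ≡ z ⊎ adj G z x ≡ true
closedNbr-cases G {z} {x} z~x with x ≟ z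
... | yes x≡z = inj₁ x≡z
... | no _    = inj₂ z~x

nbrCount-∪ : (G : Graph) {A B : VSet G} → Disjoint {G} A B → ∀ z →
  nbrCount G (_∪_ {G} A B) z ≡ nbrCount G A z + nbrCount G B z
nbrCount-∪ G {A} {B} disj z = ≡.trans (count-cong ∧-distrib) (count-∨ _ _ disj′)
  where
  ∧-distrib : ∀ u → closedNbr G z u ∧ (A u ∨ B u) ≡ (closedNbr G z u ∧ A u) ∨ (closedNbr G z u ∧ B u)
  ∧-distrib u = ∧-distribˡ-∨ (closedNbr G z u) (A u) (B u)
  disj′ : ∀ u → (closedNbr G z u ∧ A u) ∧ (closedNbr G z u ∧ B u) ≡ false
  disj′ u with closedNbr G z u | A u | B u | disj u
  ... | false | _     | _     | _  = refl
  ... | true  | false | _     | _  = refl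
  ... | true  | true  | false | _  = refl

∑-nbrCount-part : (G : Graph) {k : ℕ} (Ω : Partition G k) (z : Vertex G) →
  ∑[ i < k ] nbrCount G (part Ω i) z ≡ suc (deg G z)
∑-nbrCount-part G Ω z = ≡.trans (∑-count-fibres (label Ω) (closedNbr G z)) (closedNbr-size G z)

part-disjoint : (G : Graph) {k : ℕ} (Ω : Partition G k) {i i′ : Fin k} → i ≢ i′ →
  Disjoint {G} (part Ω i) (part Ω i′)
part-disjoint G Ω {i} {i′} i≢i′ u with label Ω u ≟ i | label Ω u ≟ i′
... | yes refl | yes refl = ⊥-elim (i≢i′ refl)
... | yes _    | no _     = refl
... | no _     | _        = refl

coalition-sym : (G : Graph) {U W : VSet G} → IsDoubleCoalition G U W → IsDoubleCoalition G W U
coalition-sym G {U} {W} (disj , ¬ddU , ¬ddW , ddU∪W) =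
  (λ u → ≡.trans (∧-comm (W u) (U u)) (disj u)) , ¬ddW , ¬ddU ,
  λ z → subst (2 ≤_) (count-cong (λ u → cong (closedNbr G z u ∧_) (∨-comm (U u) (W u)))) (ddU∪W z)

not-double-dominating : (G : Graph) (S : VSet G) (z : Vertex G) →
  (∀ x y → closedNbr G z x ∧ S x ≡ true → closedNbr G z y ∧ S y ≡ true → x ≡ y) →
  ¬ IsDoubleDominating G S
not-double-dominating G S z unique dd with ≤-trans (dd z) (count-≤1 _ unique)
... | s≤s ()

Reachable-trans : ∀ {n} {adj : Fin n → Fin n → Bool} {u v w} →
  Reachable adj u v → Reachable adj v w → Reachable adj u w
Reachable-trans here           v⇝w = v⇝w
Reachable-trans (step e u⇝v) v⇝w = step e (Reachable-trans u⇝v v⇝w)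

Reachable-sym : ∀ {n} {adj : Fin n → Fin n → Bool} → (∀ u v → adj u v ≡ adj v u) →
  ∀ {u v} → Reachable adj u v → Reachable adj v u
Reachable-sym adj-sym here                   = here
Reachable-sym adj-sym (step {u} {w} u~w w⇝v) =
  Reachable-trans (Reachable-sym adj-sym w⇝v) (step (≡.trans (adj-sym w u) u~w) here)

-- Arithmetic

heavyᵇ lightᵇ absentᵇ : ℕ → Bool
heavyᵇ x  = 1 <ᵇ x
lightᵇ x  = x ≡ᵇ 1
absentᵇ x = x ≡ᵇ 0

heavy+light+absent≡1 : ∀ x → 𝟙[ heavyᵇ x ] + 𝟙[ lightᵇ x ] + 𝟙[ absentᵇ x ] ≡ 1
heavy+light+absent≡1 0             = refl
heavy+light+absent≡1 1             = refl
heavy+light+absent≡1 (suc (suc x)) = refl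

2*heavy+light≤ : ∀ x → 2 * 𝟙[ heavyᵇ x ] + 𝟙[ lightᵇ x ] ≤ x
2*heavy+light≤ 0             = z≤n
2*heavy+light≤ 1             = s≤s z≤n
2*heavy+light≤ (suc (suc x)) = s≤s (s≤s z≤n)

absent+2≤⇒heavy : ∀ {x y} → absentᵇ x ≡ true → 2 ≤ x + y → heavyᵇ y ≡ true
absent+2≤⇒heavy {0} {suc (suc y)} _ _           = refl
absent+2≤⇒heavy {0} {1}           _ (s≤s ())

heavy⇒¬absent : ∀ {x} → heavyᵇ x ≡ true → absentᵇ x ≡ false
heavy⇒¬absent {suc (suc x)} _ = refl

0<ᵇ⇒1≤ : ∀ {x} → (0 <ᵇ x) ≡ true → 1 ≤ x
0<ᵇ⇒1≤ {suc x} _ = s≤s z≤n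

≤-if-0<ᵇ : ∀ x {y} → ((0 <ᵇ x) ≡ true → x ≤ y) → x ≤ (if 0 <ᵇ x then y else 0)
≤-if-0<ᵇ zero    _   = z≤n
≤-if-0<ᵇ (suc x) x≤y = x≤y refl

2≤e+[2∸e]*p : ∀ e {p} → 1 ≤ p → 2 ≤ e + (2 ∸ e) * p
2≤e+[2∸e]*p 0             {p} 1≤p = *-monoʳ-≤ 2 1≤p
2≤e+[2∸e]*p 1             {p} 1≤p = s≤s (≤-trans 1≤p (m≤m+n p 0))
2≤e+[2∸e]*p (suc (suc e))     _   = s≤s (s≤s z≤n)

1+p≤e+[2∸e]*p : ∀ {e p} → e ≤ 1 → 1 ≤ p → suc p ≤ e + (2 ∸ e) * p
1+p≤e+[2∸e]*p {0} {p} _ 1≤p = ≤-trans (+-monoˡ-≤ p 1≤p) (≤-reflexive (cong (p +_) (≡.sym (+-identityʳ p))))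
1+p≤e+[2∸e]*p {1} {p} _ _   = s≤s (≤-reflexive (≡.sym (+-identityʳ p)))
1+p≤e+[2∸e]*p {suc (suc e)} (s≤s ())

p+2[1+r]≤Δ+2 : ∀ {p r Δ} → suc p + 2 * r ≤ suc Δ → p + 2 * suc r ≤ Δ + 2
p+2[1+r]≤Δ+2 {p} {r} {Δ} h = begin
  p + 2 * suc r      ≡⟨ solve (p ∷ r ∷ []) ⟩
  suc p + 2 * r + 1  ≤⟨ +-monoˡ-≤ 1 h ⟩
  suc Δ + 1          ≡⟨ solve (Δ ∷ []) ⟩
  Δ + 2              ∎
  where open ≤-Reasoning

⌊2*n/2⌋≡n : ∀ n → ⌊ 2 * n /2⌋ ≡ n
⌊2*n/2⌋≡n n = ≡.sym (≡.trans (n≡⌊n+n/2⌋ n) (cong (λ x → ⌊ n + x /2⌋) (≡.sym (+-identityʳ n))))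

⌈2*n/2⌉≡n : ∀ n → ⌈ 2 * n /2⌉ ≡ n
⌈2*n/2⌉≡n n = ≡.sym (≡.trans (n≡⌈n+n/2⌉ n) (cong (λ x → ⌈ n + x /2⌉) (≡.sym (+-identityʳ n))))

2*m≤1+n⇒m≤⌈n/2⌉ : ∀ {m n} → 2 * m ≤ suc n → m ≤ ⌈ n /2⌉
2*m≤1+n⇒m≤⌈n/2⌉ {m} 2m≤1+n = subst (_≤ _) (⌊2*n/2⌋≡n m) (⌊n/2⌋-mono 2m≤1+n)

odd⇒≡1+2⌊n/2⌋ : ∀ n → ¬ (2 ∣ n) → n ≡ suc (2 * ⌊ n /2⌋)
odd⇒≡1+2⌊n/2⌋ zero          ¬2∣n = ⊥-elim (¬2∣n (divides 0 refl))
odd⇒≡1+2⌊n/2⌋ (suc zero)    _    = refl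
odd⇒≡1+2⌊n/2⌋ (suc (suc n)) ¬2∣n =
  ≡.trans (cong (λ x → suc (suc x)) (odd⇒≡1+2⌊n/2⌋ n (¬2∣n ∘ ∣m∣n⇒∣m+n {2} {2} {n} ∣-refl)))
          (cong suc (≡.sym (*-suc 2 ⌊ n /2⌋)))

d*[1+2x]≤d*R : ∀ x d R → 2 * (x + d) ≤ suc R → d * (1 + 2 * x) ≤ d * R
d*[1+2x]≤d*R x zero    R _ = z≤n
d*[1+2x]≤d*R x (suc d) R 2[x+d]≤1+R = *-monoʳ-≤ (suc d) (≤-pred (begin
  suc (1 + 2 * x)    ≡⟨ solve (x ∷ []) ⟩
  2 * (x + 1)        ≤⟨ *-monoʳ-≤ 2 (+-monoʳ-≤ x (s≤s z≤n)) ⟩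
  2 * (x + suc d)    ≤⟨ 2[x+d]≤1+R ⟩
  suc R              ∎))
  where open ≤-Reasoning

-- The bound with c = t′ + d and Δ + 2 = 2c + R substituted, so that no subtraction occurs.
dcBound-core : ∀ {t t′ s o d h R} → t′ ≤ t → 2 * (t′ + d) ≤ suc R →
  2 * t + s ≤ suc (t′ + d + h) → o ≤ t′ * (2 * d + R) →
  t + s + o ≤ (t′ + d) * R + 1 + h
dcBound-core {t} {t′} {s} {o} {d} {h} {R} t′≤t 2c≤1+R 2t+s≤ o≤ = begin
  t + s + o                           ≤⟨ +-mono-≤ t+s≤ o≤ ⟩
  suc (d + h) + t′ * (2 * d + R)      ≡⟨ solve (d ∷ h ∷ t′ ∷ R ∷ []) ⟩
  suc h + t′ * R + d * (1 + 2 * t′)   ≤⟨ +-monoʳ-≤ (suc h + t′ * R) (d*[1+2x]≤d*R t′ d R 2c≤1+R) ⟩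
  suc h + t′ * R + d * R              ≡⟨ solve (d ∷ h ∷ t′ ∷ R ∷ []) ⟩
  (t′ + d) * R + 1 + h                ∎
  where
  open ≤-Reasoning
  t+s≤ : t + s ≤ suc (d + h)
  t+s≤ = +-cancelˡ-≤ t′ (t + s) (suc (d + h)) (begin
    t′ + (t + s)       ≤⟨ +-monoˡ-≤ (t + s) t′≤t ⟩
    t + (t + s)        ≡⟨ solve (t ∷ s ∷ []) ⟩
    2 * t + s          ≤⟨ 2t+s≤ ⟩
    suc (t′ + d + h)   ≡⟨ solve (t′ ∷ d ∷ h ∷ []) ⟩
    t′ + suc (d + h)   ∎)

dcBound-arith : ∀ {t t′ s o c h Δ} → t′ ≤ t → t ≤ c → 4 * c ≤ Δ + 3 →
  2 * t + s ≤ suc (c + h) → o ≤ t′ * (Δ + 2 ∸ 2 * t′) →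
  t + s + o ≤ c * (Δ + 2 ∸ 2 * c) + 1 + h
dcBound-arith {t} {t′} {s} {o} {c} {h} {Δ} t′≤t t≤c 4c≤Δ+3 2t+s≤ o≤ =
  subst (λ x → t + s + o ≤ x * R + 1 + h) t′+d≡c
    (dcBound-core t′≤t 2c≤1+R (subst (λ x → 2 * t + s ≤ suc (x + h)) (≡.sym t′+d≡c) 2t+s≤)
                  (subst (λ x → o ≤ t′ * x) Δ+2∸2t′≡2d+R o≤))
  where
  open ≤-Reasoning
  d = c ∸ t′
  R = Δ + 2 ∸ 2 * c
  t′+d≡c : t′ + d ≡ c
  t′+d≡c = m+[n∸m]≡n (≤-trans t′≤t t≤c)
  2c≤Δ+2 : 2 * c ≤ Δ + 2
  2c≤Δ+2 = *-cancelˡ-≤ 2 (begin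
    2 * (2 * c)   ≡⟨ solve (c ∷ []) ⟩
    4 * c         ≤⟨ 4c≤Δ+3 ⟩
    Δ + 3         ≤⟨ +-monoʳ-≤ Δ (m≤n+m 3 (Δ + 1)) ⟩
    Δ + (Δ + 1 + 3) ≡⟨ solve (Δ ∷ []) ⟩
    2 * (Δ + 2)   ∎)
  2c+R≡Δ+2 : 2 * c + R ≡ Δ + 2
  2c+R≡Δ+2 = m+[n∸m]≡n 2c≤Δ+2
  2c≤1+R : 2 * (t′ + d) ≤ suc R
  2c≤1+R = +-cancelˡ-≤ (2 * c) (2 * (t′ + d)) (suc R) (begin
    2 * c + 2 * (t′ + d)  ≡⟨ cong (λ x → 2 * c + 2 * x) t′+d≡c ⟩
    2 * c + 2 * c         ≡⟨ solve (c ∷ []) ⟩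
    4 * c                 ≤⟨ 4c≤Δ+3 ⟩
    Δ + 3                 ≡⟨ ≡.trans (cong (_+ 1) 2c+R≡Δ+2) (+-assoc Δ 2 1) ⟨
    2 * c + R + 1         ≡⟨ +-assoc (2 * c) R 1 ⟩
    2 * c + (R + 1)       ≡⟨ cong (2 * c +_) (+-comm R 1) ⟩
    2 * c + suc R         ∎)
  Δ+2∸2t′≡2d+R : Δ + 2 ∸ 2 * t′ ≡ 2 * d + R
  Δ+2∸2t′≡2d+R = ≡.trans (cong (_∸ 2 * t′) (begin-equality
    Δ + 2                    ≡⟨ 2c+R≡Δ+2 ⟨
    2 * c + R                ≡⟨ cong (λ x → 2 * x + R) t′+d≡c ⟨
    2 * (t′ + d) + R         ≡⟨ cong (_+ R) (*-distribˡ-+ 2 t′ d) ⟩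
    2 * t′ + 2 * d + R       ≡⟨ +-assoc (2 * t′) (2 * d) R ⟩
    2 * t′ + (2 * d + R)     ∎)) (m+n∸m≡n (2 * t′) (2 * d + R))

-- The upper bound

module UpperBound {G : Graph} {k : ℕ} (Ω : Partition G k)
                  (dc : IsDoubleCoalitionPartition G k Ω) (v : Vertex G) where

  partner : Fin k → Fin k
  partner i = proj₁ (dc i)

  class-not-dominating : ∀ i → ¬ IsDoubleDominating G (part Ω i)
  class-not-dominating i with _ , _ , _ , ¬dd , _ ← dc i = ¬dd

  hits : Vertex G → Fin k → ℕ
  hits u i = nbrCount G (part Ω i) u

  hits-partner : ∀ u i → 2 ≤ hits u i + hits u (partner i)
  hits-partner u i with _ , _ , disj , _ , _ , dd ← dc i = subst (2 ≤_) (nbrCount-∪ G disj u) (dd u)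

  heavy light absent : Fin k → Bool
  heavy i  = heavyᵇ (hits v i)
  light i  = lightᵇ (hits v i)
  absent i = absentᵇ (hits v i)

  nHeavy nLight nAbsent : ℕ
  nHeavy  = count heavy
  nLight  = count light
  nAbsent = count absent

  k≡nHeavy+nLight+nAbsent : k ≡ nHeavy + nLight + nAbsent
  k≡nHeavy+nLight+nAbsent = begin
    k                                                     ≡⟨ count-true k ⟨
    count {k} (λ _ → true)                                ≡⟨ count≡∑ {k} (λ _ → true) ⟩
    ∑[ i < k ] 1                                          ≡⟨ sum-cong-≗ (λ i → heavy+light+absent≡1 (hits v i)) ⟨
    ∑[ i < k ] (𝟙[ heavy i ] + 𝟙[ light i ] + 𝟙[ absent i ])
      ≡⟨ ∑-distrib-+ (λ i → 𝟙[ heavy i ] + 𝟙[ light i ]) (λ i → 𝟙[ absent i ]) ⟩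
    ∑[ i < k ] (𝟙[ heavy i ] + 𝟙[ light i ]) + ∑[ i < k ] 𝟙[ absent i ]
      ≡⟨ cong (_+ ∑[ i < k ] 𝟙[ absent i ]) (∑-distrib-+ (λ i → 𝟙[ heavy i ]) (λ i → 𝟙[ light i ])) ⟩
    ∑[ i < k ] 𝟙[ heavy i ] + ∑[ i < k ] 𝟙[ light i ] + ∑[ i < k ] 𝟙[ absent i ]
      ≡⟨ cong₂ _+_ (cong₂ _+_ (count≡∑ heavy) (count≡∑ light)) (count≡∑ absent) ⟨
    nHeavy + nLight + nAbsent                             ∎
    where open ≡-Reasoning

  2*nHeavy+nLight≤ : 2 * nHeavy + nLight ≤ suc (deg G v)
  2*nHeavy+nLight≤ = begin
    2 * nHeavy + nLight
      ≡⟨ cong₂ _+_ (≡.trans (cong (2 *_) (count≡∑ heavy)) (*-distribˡ-sum 2 (λ i → 𝟙[ heavy i ])))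
                   (count≡∑ light) ⟩
    ∑[ i < k ] (2 * 𝟙[ heavy i ]) + ∑[ i < k ] 𝟙[ light i ]
      ≡⟨ ∑-distrib-+ (λ i → 2 * 𝟙[ heavy i ]) (λ i → 𝟙[ light i ]) ⟨
    ∑[ i < k ] (2 * 𝟙[ heavy i ] + 𝟙[ light i ])  ≤⟨ sum-mono-≤ (λ i → 2*heavy+light≤ (hits v i)) ⟩
    ∑[ i < k ] hits v i                           ≡⟨ ∑-nbrCount-part G Ω v ⟩
    suc (deg G v)                                 ∎
    where open ≤-Reasoning

  absent⇒partner-heavy : ∀ i → absent i ≡ true → heavy (partner i) ≡ true
  absent⇒partner-heavy i absent-i = absent+2≤⇒heavy {hits v i} absent-i (hits-partner v i)

  satellites : Fin k → ℕ
  satellites j = count (λ i → absent i ∧ ⌊ partner i ≟ j ⌋)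

  nAbsent≡∑satellites : nAbsent ≡ ∑[ j < k ] satellites j
  nAbsent≡∑satellites = ≡.sym (∑-count-fibres partner absent)

  satellites-of-non-heavy : ∀ j → heavy j ≡ false → satellites j ≡ 0
  satellites-of-non-heavy j not-heavy = count-false not-satellite
    where
    not-satellite : ∀ i → absent i ∧ ⌊ partner i ≟ j ⌋ ≡ false
    not-satellite i with absent i in absent-i | partner i ≟ j
    ... | false | _        = refl
    ... | true  | no _     = refl
    ... | true  | yes refl with () ← ≡.trans (≡.sym (absent⇒partner-heavy i absent-i)) not-heavy

  hub : Fin k → Bool
  hub j = 0 <ᵇ satellites j

  nHubs : ℕ
  nHubs = count hub

  hub⇒heavy : ∀ j → hub j ≡ true → heavy j ≡ true
  hub⇒heavy j hub-j with heavy j in heavy-j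
  ... | true  = refl
  ... | false with () ← ≡.trans (≡.sym hub-j) (cong (0 <ᵇ_) (satellites-of-non-heavy j heavy-j))

  nHubs≤nHeavy : nHubs ≤ nHeavy
  nHubs≤nHeavy = count-mono hub⇒heavy

  cluster : Fin k → Fin k
  cluster i = if absent i then partner i else i

  load : Vertex G → Fin k → ℕ
  load u j = ∑[ i < k ] (if ⌊ cluster i ≟ j ⌋ then hits u i else 0)

  ∑-load : ∀ u → ∑[ j < k ] load u j ≡ suc (deg G u)
  ∑-load u = ≡.trans (∑-fibres cluster (hits u)) (∑-nbrCount-part G Ω u)

  load-lower : ∀ u j → absent j ≡ false → hits u j + (2 ∸ hits u j) * satellites j ≤ load u j
  load-lower u j not-absent = begin
    hits u j + (2 ∸ hits u j) * satellites j
      ≡⟨ cong₂ _+_ (∑-δ j (hits u)) (∑-if (λ i → absent i ∧ ⌊ partner i ≟ j ⌋) (2 ∸ hits u j)) ⟨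
    sum own + sum rescue       ≡⟨ ∑-distrib-+ own rescue ⟨
    ∑[ i < k ] (own i + rescue i)  ≤⟨ sum-mono-≤ own+rescue≤ ⟩
    load u j                   ∎
    where
    open ≤-Reasoning
    own rescue : Fin k → ℕ
    own i    = if ⌊ i ≟ j ⌋ then hits u i else 0
    rescue i = if absent i ∧ ⌊ partner i ≟ j ⌋ then 2 ∸ hits u j else 0
    own+rescue≤ : ∀ i → own i + rescue i ≤ (if ⌊ cluster i ≟ j ⌋ then hits u i else 0)
    own+rescue≤ i with i ≟ j
    ... | yes refl rewrite not-absent | ≟-refl i = ≤-reflexive (+-identityʳ (hits u i))
    ... | no i≢j with absent i
    ...   | false rewrite ≟-≢ i≢j = z≤n
    ...   | true with partner i ≟ j
    ...     | no _     = z≤n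
    ...     | yes refl = m≤n+o⇒m∸n≤o 2 (hits u (partner i))
                           (subst (2 ≤_) (+-comm (hits u i) _) (hits-partner u i))

  hub-load : ∀ u j → 2 * 𝟙[ hub j ] ≤ load u j
  hub-load u j with hub j in hub-j
  ... | false = z≤n
  ... | true  = ≤-trans (2≤e+[2∸e]*p (hits u j) (0<ᵇ⇒1≤ hub-j))
                        (load-lower u j (heavy⇒¬absent {hits v j} (hub⇒heavy j hub-j)))

  module _ {Δ : ℕ} (deg≤Δ : ∀ u → deg G u ≤ Δ) where

    satellites+2*nHubs≤ : ∀ j → hub j ≡ true → satellites j + 2 * nHubs ≤ Δ + 2
    satellites+2*nHubs≤ j hub-j
      with u , ¬2≤hits ← ¬∀⟶∃¬ (n G) (λ u → 2 ≤ hits u j) (λ u → 2 ≤? hits u j) (class-not-dominating j)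
      = subst (λ h → satellites j + 2 * h ≤ Δ + 2) (≡.sym nHubs≡) (p+2[1+r]≤Δ+2 (begin
      suc (satellites j) + 2 * others          ≡⟨ cong (suc (satellites j) +_) (*-distribˡ-sum 2 other-hub) ⟩
      suc (satellites j) + ∑[ i < k ] (2 * other-hub i)
        ≤⟨ +-mono-≤ (≤-trans (1+p≤e+[2∸e]*p (≤-pred (≰⇒> ¬2≤hits)) (0<ᵇ⇒1≤ hub-j)) (load-lower u j not-absent))
                    (sum-mono-≤ other-load) ⟩
      load u j + ∑[ i < k ] (if ⌊ i ≟ j ⌋ then 0 else load u i)   ≡⟨ sum-split (load u) j ⟨
      ∑[ i < k ] load u i                      ≡⟨ ∑-load u ⟩
      suc (deg G u)                            ≤⟨ s≤s (deg≤Δ u) ⟩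
      suc Δ                                    ∎))
      where
      open ≤-Reasoning
      not-absent : absent j ≡ false
      not-absent = heavy⇒¬absent {hits v j} (hub⇒heavy j hub-j)
      other-hub : Fin k → ℕ
      other-hub i = if ⌊ i ≟ j ⌋ then 0 else 𝟙[ hub i ]
      others : ℕ
      others = sum other-hub
      nHubs≡ : nHubs ≡ suc others
      nHubs≡ = ≡.trans (count≡∑ hub) (≡.trans (sum-split (λ i → 𝟙[ hub i ]) j) (cong (λ b → 𝟙[ b ] + others) hub-j))
      other-load : ∀ i → 2 * other-hub i ≤ (if ⌊ i ≟ j ⌋ then 0 else load u i)
      other-load i with ⌊ i ≟ j ⌋
      ... | true  = z≤n
      ... | false = hub-load u i

    nAbsent≤ : nAbsent ≤ nHubs * (Δ + 2 ∸ 2 * nHubs)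
    nAbsent≤ = begin
      nAbsent                                           ≡⟨ nAbsent≡∑satellites ⟩
      ∑[ j < k ] satellites j                           ≤⟨ sum-mono-≤ satellites≤ ⟩
      ∑[ j < k ] (if hub j then Δ + 2 ∸ 2 * nHubs else 0)  ≡⟨ ∑-if hub (Δ + 2 ∸ 2 * nHubs) ⟩
      (Δ + 2 ∸ 2 * nHubs) * nHubs                       ≡⟨ *-comm (Δ + 2 ∸ 2 * nHubs) nHubs ⟩
      nHubs * (Δ + 2 ∸ 2 * nHubs)                       ∎
      where
      open ≤-Reasoning
      satellites≤ : ∀ j → satellites j ≤ (if hub j then Δ + 2 ∸ 2 * nHubs else 0)
      satellites≤ j = ≤-if-0<ᵇ (satellites j) (λ hub-j → m+n≤o⇒m≤o∸n (satellites j) (satellites+2*nHubs≤ j hub-j))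

dc-upper-bound : (G : Graph) (δ Δ : ℕ) → MinDegree G δ → MaxDegree G Δ → 4 * ⌈ δ /2⌉ ∸ 3 ≤ Δ →
  ∀ k → HasDCPartition G k → k ≤ dcBound δ Δ
dc-upper-bound G δ Δ (_ , v , deg-v≡δ) (deg≤Δ , _) 4c∸3≤Δ k (Ω , dc) =
  subst (_≤ dcBound δ Δ) (≡.sym k≡nHeavy+nLight+nAbsent)
    (dcBound-arith nHubs≤nHeavy (2*m≤1+n⇒m≤⌈n/2⌉ (≤-trans (m≤m+n (2 * nHeavy) nLight) 2h+l≤1+δ))
                   4c≤Δ+3 2h+l≤1+c+h (nAbsent≤ deg≤Δ))
  where
  open UpperBound Ω dc v
  open ≤-Reasoning
  2h+l≤1+δ : 2 * nHeavy + nLight ≤ suc δ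
  2h+l≤1+δ = subst (λ d → 2 * nHeavy + nLight ≤ suc d) deg-v≡δ 2*nHeavy+nLight≤
  2h+l≤1+c+h : 2 * nHeavy + nLight ≤ suc (⌈ δ /2⌉ + ⌊ δ /2⌋)
  2h+l≤1+c+h = subst (λ d → 2 * nHeavy + nLight ≤ suc d)
                     (≡.trans (≡.sym (⌊n/2⌋+⌈n/2⌉≡n δ)) (+-comm ⌊ δ /2⌋ ⌈ δ /2⌉)) 2h+l≤1+δ
  4c≤Δ+3 : 4 * ⌈ δ /2⌉ ≤ Δ + 3
  4c≤Δ+3 = begin
    4 * ⌈ δ /2⌉                  ≤⟨ m≤n+m∸n (4 * ⌈ δ /2⌉) 3 ⟩
    3 + (4 * ⌈ δ /2⌉ ∸ 3)        ≤⟨ +-monoʳ-≤ 3 4c∸3≤Δ ⟩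
    3 + Δ                        ≡⟨ +-comm 3 Δ ⟩
    Δ + 3                        ∎

-- The extremal graphs

-- For δ = 2m + 1 and c = m + 1, gadget j < c consists of two cliques on the 2c vertices inner t j k b
-- (t = 0, 1), an apex outer j 0 adjacent to all of clique 0 except inner 0 j j 0, and 2c vertices
-- outer j (r + 1) adjacent to the apex and to all of clique 1; moreover the vertices outer j 1 of all
-- gadgets form a clique.  Degrees range from 2m + 1 (inner 0 j j 0) to 4m + 3 (clique 1, apex).  The
-- classes A_k = {inner _ _ k _} and the singletons {outer j r} form the partition: A_j ∪ {outer j r}
-- is double dominating, while the apex of gadget k sees only inner 0 k k 1 in A_k.
module Construction (m : ℕ) where

  c #pendant p : ℕ
  c        = suc m
  #pendant = 2 + 2 * m
  p        = suc #pendant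

  data Vtx : Set where
    inner : Fin 2 → Fin c → Fin c → Fin 2 → Vtx
    outer : Fin c → Fin p → Vtx

  #inner N : ℕ
  #inner = 2 * (c * (c * 2))
  N      = #inner + c * p

  unpack : Fin #inner → Fin 2 × Fin c × Fin c × Fin 2
  unpack = map₂ (map₂ (remQuot 2) ∘ remQuot (c * 2)) ∘ remQuot (c * (c * 2))

  pack : Fin 2 × Fin c × Fin c × Fin 2 → Fin #inner
  pack (t , j , k , b) = combine t (combine j (combine k b))

  unpack-pack : ∀ x → unpack (pack x) ≡ x
  unpack-pack (t , j , k , b) = begin
    unpack (combine t (combine j (combine k b)))
      ≡⟨ cong (map₂ (map₂ (remQuot 2) ∘ remQuot (c * 2))) (remQuot-combine t (combine j (combine k b))) ⟩
    t , map₂ (remQuot 2) (remQuot (c * 2) (combine j (combine k b)))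
      ≡⟨ cong (λ z → t , map₂ (remQuot 2) z) (remQuot-combine j (combine k b)) ⟩
    t , j , remQuot 2 (combine k b)          ≡⟨ cong (λ z → t , j , z) (remQuot-combine k b) ⟩
    t , j , k , b                            ∎
    where open ≡-Reasoning

  pack-unpack : ∀ y → pack (unpack y) ≡ y
  pack-unpack y = begin
    combine t (combine j (combine k b))  ≡⟨ cong (λ z → combine t (combine j z)) (combine-remQuot {c} 2 z) ⟩
    combine t (combine j z)              ≡⟨ cong (combine t) (combine-remQuot {c} (c * 2) y′) ⟩
    combine t y′                         ≡⟨ combine-remQuot {2} (c * (c * 2)) y ⟩
    y                                    ∎
    where
    open ≡-Reasoning
    t = proj₁ (remQuot {2} (c * (c * 2)) y)
    y′ = proj₂ (remQuot {2} (c * (c * 2)) y)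
    j = proj₁ (remQuot {c} (c * 2) y′)
    z = proj₂ (remQuot {c} (c * 2) y′)
    k = proj₁ (remQuot {c} 2 z)
    b = proj₂ (remQuot {c} 2 z)

  decode : Fin N → Vtx
  decode x = [ (λ y → let t , j , k , b = unpack y in inner t j k b) , uncurry outer ∘ remQuot p ]′ (splitAt #inner x)

  encode : Vtx → Fin N
  encode (inner t j k b) = pack (t , j , k , b) ↑ˡ (c * p)
  encode (outer j r)     = #inner ↑ʳ combine j r

  decode-encode : ∀ w → decode (encode w) ≡ w
  decode-encode (inner t j k b) =
    ≡.trans (cong [ _ , _ ]′ (splitAt-↑ˡ #inner (pack (t , j , k , b)) (c * p)))
            (cong (λ (t , j , k , b) → inner t j k b) (unpack-pack (t , j , k , b)))
  decode-encode (outer j r) =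
    ≡.trans (cong [ _ , _ ]′ (splitAt-↑ʳ #inner (c * p) (combine j r))) (cong (uncurry outer) (remQuot-combine j r))

  encode-decode : ∀ x → encode (decode x) ≡ x
  encode-decode x with splitAt #inner x in split-x
  ... | inj₁ y = ≡.trans (cong (_↑ˡ (c * p)) (pack-unpack y)) (splitAt⁻¹-↑ˡ split-x)
  ... | inj₂ y = ≡.trans (cong (#inner ↑ʳ_) (combine-remQuot {c} p y)) (splitAt⁻¹-↑ʳ split-x)

  countV : (Vtx → Bool) → ℕ
  countV f = ∑[ t < 2 ] ∑[ j < c ] ∑[ k < c ] count (λ b → f (inner t j k b))
           + ∑[ j < c ] count (λ r → f (outer j r))

  count-decode : ∀ f → count (f ∘ decode) ≡ countV f
  count-decode f = ≡.trans (count-↑ #inner (c * p) (f ∘ decode)) (cong₂ _+_ inner-part outer-part)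
    where
    inner-part : count {#inner} (λ y → f (decode (y ↑ˡ (c * p))))
               ≡ ∑[ t < 2 ] ∑[ j < c ] ∑[ k < c ] count (λ b → f (inner t j k b))
    inner-part =
      ≡.trans (count-combine 2 (c * (c * 2)) (λ y → f (decode (y ↑ˡ (c * p))))) (sum-cong-≗ λ t →
      ≡.trans (count-combine c (c * 2) (λ y → f (decode (combine t y ↑ˡ (c * p))))) (sum-cong-≗ λ j →
      ≡.trans (count-combine c 2 (λ y → f (decode (combine t (combine j y) ↑ˡ (c * p))))) (sum-cong-≗ λ k →
      count-cong λ b → cong f (decode-encode (inner t j k b)))))
    outer-part : count {c * p} (λ y → f (decode (#inner ↑ʳ y))) ≡ ∑[ j < c ] count (λ r → f (outer j r))
    outer-part = ≡.trans (count-combine c p (λ y → f (decode (#inner ↑ʳ y))))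
                         (sum-cong-≗ λ j → count-cong λ r → cong f (decode-encode (outer j r)))

  inner-outer : Fin 2 → Fin c → Fin c → Fin 2 → Fin c → Fin p → Bool
  inner-outer zero       j k b j′ zero    = ⌊ j ≟ j′ ⌋ ∧ not (⌊ k ≟ j ⌋ ∧ ⌊ b ≟ zero ⌋)
  inner-outer zero       j k b j′ (suc _) = false
  inner-outer (suc zero) j k b j′ zero    = false
  inner-outer (suc zero) j k b j′ (suc _) = ⌊ j ≟ j′ ⌋

  outer-outer : Fin c → Fin p → Fin c → Fin p → Bool
  outer-outer j zero       j′ zero       = false
  outer-outer j zero       j′ (suc _)    = ⌊ j ≟ j′ ⌋
  outer-outer j (suc _)    j′ zero       = ⌊ j ≟ j′ ⌋
  outer-outer j (suc zero) j′ (suc zero) = not ⌊ j ≟ j′ ⌋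
  outer-outer j (suc _)    j′ (suc _)    = false

  adjV : Vtx → Vtx → Bool
  adjV (inner t j k b) (inner t′ j′ k′ b′) = ⌊ t ≟ t′ ⌋ ∧ ⌊ j ≟ j′ ⌋ ∧ not (⌊ k ≟ k′ ⌋ ∧ ⌊ b ≟ b′ ⌋)
  adjV (inner t j k b) (outer j′ r)        = inner-outer t j k b j′ r
  adjV (outer j r)     (inner t j′ k b)    = inner-outer t j′ k b j r
  adjV (outer j r)     (outer j′ r′)       = outer-outer j r j′ r′

  adjV-sym : ∀ w w′ → adjV w w′ ≡ adjV w′ w
  adjV-sym (inner t j k b) (inner t′ j′ k′ b′)
    rewrite ≟-sym t t′ | ≟-sym j j′ | ≟-sym k k′ | ≟-sym b b′ = refl
  adjV-sym (inner _ _ _ _) (outer _ _) = refl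
  adjV-sym (outer _ _) (inner _ _ _ _) = refl
  adjV-sym (outer j zero)             (outer j′ zero)             = refl
  adjV-sym (outer j zero)             (outer j′ (suc _))          = ≟-sym j j′
  adjV-sym (outer j (suc _))          (outer j′ zero)             = ≟-sym j j′
  adjV-sym (outer j (suc zero))       (outer j′ (suc zero))       = cong not (≟-sym j j′)
  adjV-sym (outer j (suc zero))       (outer j′ (suc (suc _)))    = refl
  adjV-sym (outer j (suc (suc _)))    (outer j′ (suc zero))       = refl
  adjV-sym (outer j (suc (suc _)))    (outer j′ (suc (suc _)))    = refl

  adjV-irrefl : ∀ w → adjV w w ≡ false
  adjV-irrefl (inner t j k b) rewrite ≟-refl t | ≟-refl j | ≟-refl k | ≟-refl b = refl
  adjV-irrefl (outer j zero)          = refl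
  adjV-irrefl (outer j (suc zero))    rewrite ≟-refl j = refl
  adjV-irrefl (outer j (suc (suc _))) = refl

  adjacent : Fin N → Fin N → Bool
  adjacent x y = adjV (decode x) (decode y)

  edge : ∀ w w′ → adjV w w′ ≡ true → Reachable adjacent (encode w) (encode w′)
  edge w w′ e = step (≡.trans (cong₂ adjV (decode-encode w) (decode-encode w′)) e) here

  link⇝root : ∀ j → Reachable adjacent (encode (outer j (suc zero))) (encode (outer zero (suc zero)))
  link⇝root j with j ≟ zero
  ... | yes refl = here
  ... | no j≢0   = edge (outer j (suc zero)) (outer zero (suc zero)) (cong not (≟-≢ j≢0))

  apex⇝root : ∀ j → Reachable adjacent (encode (outer j zero)) (encode (outer zero (suc zero)))
  apex⇝root j = Reachable-trans (edge (outer j zero) (outer j (suc zero)) (≟-refl j)) (link⇝root j)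

  ⇝root : ∀ w → Reachable adjacent (encode w) (encode (outer zero (suc zero)))
  ⇝root (outer j zero)          = apex⇝root j
  ⇝root (outer j (suc zero))    = link⇝root j
  ⇝root (outer j (suc (suc r))) =
    Reachable-trans (edge (outer j (suc (suc r))) (outer j zero) (≟-refl j)) (apex⇝root j)
  ⇝root (inner (suc zero) j k b) =
    Reachable-trans (edge (inner (suc zero) j k b) (outer j (suc zero)) (≟-refl j)) (link⇝root j)
  ⇝root (inner zero j k b) with ⌊ k ≟ j ⌋ ∧ ⌊ b ≟ zero ⌋ in kb≡j0
  ... | false =
    Reachable-trans (edge (inner zero j k b) (outer j zero) (cong₂ (λ x y → x ∧ not y) (≟-refl j) kb≡j0))
                    (apex⇝root j)
  ... | true  =
    Reachable-trans (edge (inner zero j k b) (inner zero j j (suc zero)) to-twin)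
      (Reachable-trans (edge (inner zero j j (suc zero)) (outer j zero) twin-to-apex) (apex⇝root j))
    where
    to-twin : adjV (inner zero j k b) (inner zero j j (suc zero)) ≡ true
    to-twin rewrite ≟-refl j | ≟-true (∧-conicalʳ ⌊ k ≟ j ⌋ ⌊ b ≟ zero ⌋ kb≡j0) = cong not (∧-zeroʳ ⌊ k ≟ j ⌋)
    twin-to-apex : adjV (inner zero j j (suc zero)) (outer j zero) ≡ true
    twin-to-apex rewrite ≟-refl j = refl

  G : Graph
  G = record
    { n         = N
    ; adj       = adjacent
    ; sym       = λ x y → adjV-sym (decode x) (decode y)
    ; irrefl    = λ x → adjV-irrefl (decode x)
    ; connected = λ x y → subst₂ (Reachable adjacent) (encode-decode x) (encode-decode y)
                    (Reachable-trans (⇝root (decode x))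
                                     (Reachable-sym (λ u v → adjV-sym (decode u) (decode v)) (⇝root (decode y))))
    }

  inner-nbrs outer-nbrs degV : Vtx → ℕ
  inner-nbrs w = ∑[ t < 2 ] ∑[ j < c ] ∑[ k < c ] count (λ b → adjV w (inner t j k b))
  outer-nbrs w = ∑[ j < c ] count (λ r → adjV w (outer j r))
  degV w       = inner-nbrs w + outer-nbrs w

  deg≡degV : ∀ x → deg G x ≡ degV (decode x)
  deg≡degV x = count-decode (adjV (decode x))

  deg-encode : ∀ w → deg G (encode w) ≡ degV w
  deg-encode w = ≡.trans (deg≡degV (encode w)) (cong degV (decode-encode w))

  ∑-clique : ∀ (k : Fin c) (b : Fin 2) → ∑[ k′ < c ] count (λ b′ → not (⌊ k ≟ k′ ⌋ ∧ ⌊ b ≟ b′ ⌋)) ≡ suc (2 * m)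
  ∑-clique k b = begin
    sum f                                                 ≡⟨ sum-split f k ⟩
    f k + ∑[ k′ < c ] (if ⌊ k′ ≟ k ⌋ then 0 else f k′)    ≡⟨ cong₂ _+_ fk≡1 (sum-cong-≗ others≡2) ⟩
    1 + ∑[ k′ < c ] (if not ⌊ k′ ≟ k ⌋ then 2 else 0)     ≡⟨ cong suc (∑-if (λ k′ → not ⌊ k′ ≟ k ⌋) 2) ⟩
    1 + 2 * count (λ k′ → not ⌊ k′ ≟ k ⌋)                 ≡⟨ cong (λ x → suc (2 * x)) (count-≢ k) ⟩
    suc (2 * m)                                           ∎
    where
    open ≡-Reasoning
    f : Fin c → ℕ
    f k′ = count (λ b′ → not (⌊ k ≟ k′ ⌋ ∧ ⌊ b ≟ b′ ⌋))
    fk≡1 : f k ≡ 1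
    fk≡1 rewrite ≟-refl k = ≡.trans (count-cong (λ b′ → cong not (≟-sym b b′))) (count-≢ b)
    others≡2 : ∀ k′ → (if ⌊ k′ ≟ k ⌋ then 0 else f k′) ≡ (if not ⌊ k′ ≟ k ⌋ then 2 else 0)
    others≡2 k′ with k′ ≟ k
    ... | yes _   = refl
    ... | no k′≢k rewrite ≟-≢ (k′≢k ∘ ≡.sym) = refl

  inner-nbrs-inner : ∀ t j k b → inner-nbrs (inner t j k b) ≡ suc (2 * m)
  inner-nbrs-inner t j k b = begin
    ∑[ t′ < 2 ] ∑[ j′ < c ] ∑[ k′ < c ] count (λ b′ → ⌊ t ≟ t′ ⌋ ∧ ⌊ j ≟ j′ ⌋ ∧ clique k′ b′)
      ≡⟨ sum-cong-≗ (λ t′ → ∑∑-count-guard ⌊ t ≟ t′ ⌋ (λ j′ k′ b′ → ⌊ j ≟ j′ ⌋ ∧ clique k′ b′)) ⟩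
    ∑[ t′ < 2 ] (if ⌊ t ≟ t′ ⌋ then ∑[ j′ < c ] ∑[ k′ < c ] count (λ b′ → ⌊ j ≟ j′ ⌋ ∧ clique k′ b′) else 0)
      ≡⟨ ∑-δ′ t (λ _ → ∑[ j′ < c ] ∑[ k′ < c ] count (λ b′ → ⌊ j ≟ j′ ⌋ ∧ clique k′ b′)) ⟩
    ∑[ j′ < c ] ∑[ k′ < c ] count (λ b′ → ⌊ j ≟ j′ ⌋ ∧ clique k′ b′)
      ≡⟨ sum-cong-≗ (λ j′ → ∑-count-guard ⌊ j ≟ j′ ⌋ clique) ⟩
    ∑[ j′ < c ] (if ⌊ j ≟ j′ ⌋ then ∑[ k′ < c ] count (clique k′) else 0)
      ≡⟨ ∑-δ′ j (λ _ → ∑[ k′ < c ] count (clique k′)) ⟩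
    ∑[ k′ < c ] count (clique k′)                                     ≡⟨ ∑-clique k b ⟩
    suc (2 * m)                                                        ∎
    where
    open ≡-Reasoning
    clique : Fin c → Fin 2 → Bool
    clique k′ b′ = not (⌊ k ≟ k′ ⌋ ∧ ⌊ b ≟ b′ ⌋)

  outer-nbrs-inner₀ : ∀ j k b → outer-nbrs (inner zero j k b) ≡ 𝟙[ not (⌊ k ≟ j ⌋ ∧ ⌊ b ≟ zero ⌋) ]
  outer-nbrs-inner₀ j k b = ≡.trans (sum-cong-≗ per-apex) (∑-δ′ j (λ _ → 𝟙[ not (⌊ k ≟ j ⌋ ∧ ⌊ b ≟ zero ⌋) ]))
    where
    per-apex : ∀ j′ → count (λ r → inner-outer zero j k b j′ r)
                    ≡ (if ⌊ j ≟ j′ ⌋ then 𝟙[ not (⌊ k ≟ j ⌋ ∧ ⌊ b ≟ zero ⌋) ] else 0)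
    per-apex j′ rewrite count-false {P = λ (_ : Fin #pendant) → false} (λ _ → refl) with ⌊ j ≟ j′ ⌋
    ... | true  = +-identityʳ _
    ... | false = refl

  outer-nbrs-inner₁ : ∀ j k b → outer-nbrs (inner (suc zero) j k b) ≡ #pendant
  outer-nbrs-inner₁ j k b = ≡.trans (sum-cong-≗ (λ j′ → count-const {#pendant} ⌊ j ≟ j′ ⌋)) (∑-δ′ j (λ _ → #pendant))

  inner-nbrs-outer₀ : ∀ j → inner-nbrs (outer j zero) ≡ suc (2 * m)
  inner-nbrs-outer₀ j = begin
    via-clique₀ + (via-clique₁ + 0)   ≡⟨ cong (λ x → via-clique₀ + (x + 0)) via-clique₁≡0 ⟩
    via-clique₀ + 0                   ≡⟨ +-identityʳ via-clique₀ ⟩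
    via-clique₀                       ≡⟨ sum-cong-≗ (λ j′ → ∑-count-guard ⌊ j′ ≟ j ⌋ (seen j′)) ⟩
    ∑[ j′ < c ] (if ⌊ j′ ≟ j ⌋ then ∑[ k′ < c ] count (seen j′ k′) else 0)
                                      ≡⟨ ∑-δ j (λ j′ → ∑[ k′ < c ] count (seen j′ k′)) ⟩
    ∑[ k′ < c ] count (seen j k′)
      ≡⟨ sum-cong-≗ (λ k′ → count-cong (λ (b′ : Fin 2) → cong₂ (λ x y → not (x ∧ y)) (≟-sym k′ j) (≟-sym b′ zero))) ⟩
    ∑[ k′ < c ] count (λ (b′ : Fin 2) → not (⌊ j ≟ k′ ⌋ ∧ ⌊ zero ≟ b′ ⌋))   ≡⟨ ∑-clique j zero ⟩
    suc (2 * m)                                                   ∎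
    where
    open ≡-Reasoning
    seen : Fin c → Fin c → Fin 2 → Bool
    seen j′ k′ b′ = not (⌊ k′ ≟ j′ ⌋ ∧ ⌊ b′ ≟ zero ⌋)
    via-clique₀ via-clique₁ : ℕ
    via-clique₀ = ∑[ j′ < c ] ∑[ k′ < c ] count (λ b′ → inner-outer zero j′ k′ b′ j zero)
    via-clique₁ = ∑[ j′ < c ] ∑[ k′ < c ] count (λ b′ → inner-outer (suc zero) j′ k′ b′ j zero)
    via-clique₁≡0 : via-clique₁ ≡ 0
    via-clique₁≡0 =
      sum-zero (λ j′ → sum-zero {c} {λ k′ → count (λ b′ → inner-outer (suc zero) j′ k′ b′ j zero)} (λ _ → refl))

  outer-nbrs-outer₀ : ∀ j → outer-nbrs (outer j zero) ≡ #pendant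
  outer-nbrs-outer₀ j = ≡.trans (sum-cong-≗ (λ j′ → count-const {#pendant} ⌊ j ≟ j′ ⌋)) (∑-δ′ j (λ _ → #pendant))

  inner-nbrs-outer₊ : ∀ j r → inner-nbrs (outer j (suc r)) ≡ 2 * c
  inner-nbrs-outer₊ j r = begin
    via-clique₀ + (via-clique₁ + 0)  ≡⟨ cong₂ (λ x y → x + (y + 0)) via-clique₀≡0 (sum-cong-≗ per-index) ⟩
    0 + (∑[ j′ < c ] (if ⌊ j′ ≟ j ⌋ then 2 * c else 0) + 0)   ≡⟨ +-identityʳ _ ⟩
    ∑[ j′ < c ] (if ⌊ j′ ≟ j ⌋ then 2 * c else 0)             ≡⟨ ∑-δ j (λ _ → 2 * c) ⟩
    2 * c                                                    ∎
    where
    open ≡-Reasoning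
    via-clique₀ via-clique₁ : ℕ
    via-clique₀ = ∑[ j′ < c ] ∑[ k′ < c ] count (λ b′ → inner-outer zero j′ k′ b′ j (suc r))
    via-clique₁ = ∑[ j′ < c ] ∑[ k′ < c ] count (λ b′ → inner-outer (suc zero) j′ k′ b′ j (suc r))
    via-clique₀≡0 : via-clique₀ ≡ 0
    via-clique₀≡0 =
      sum-zero (λ j′ → sum-zero {c} {λ k′ → count (λ b′ → inner-outer zero j′ k′ b′ j (suc r))} (λ _ → refl))
    per-index : ∀ j′ → ∑[ k′ < c ] count (λ b′ → inner-outer (suc zero) j′ k′ b′ j (suc r))
                     ≡ (if ⌊ j′ ≟ j ⌋ then 2 * c else 0)
    per-index j′ with ⌊ j′ ≟ j ⌋
    ... | true  = ∑-const c 2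
    ... | false = sum-zero {c} {λ _ → 0} (λ _ → refl)

  outer-nbrs-outer₊ : ∀ j r → outer-nbrs (outer j (suc r)) ≤ c
  outer-nbrs-outer₊ j r = ≤-trans (sum-mono-≤ (per-index r)) (≤-reflexive (≡.trans (∑-const c 1) (*-identityˡ c)))
    where
    per-index : ∀ r j′ → count (λ r′ → outer-outer j (suc r) j′ r′) ≤ 1
    per-index zero j′ = begin
      𝟙[ ⌊ j ≟ j′ ⌋ ] + (𝟙[ not ⌊ j ≟ j′ ⌋ ] + count {1 + 2 * m} (λ _ → false))
        ≡⟨ cong (λ x → 𝟙[ ⌊ j ≟ j′ ⌋ ] + (𝟙[ not ⌊ j ≟ j′ ⌋ ] + x))
                (count-false {1 + 2 * m} {λ _ → false} (λ _ → refl)) ⟩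
      𝟙[ ⌊ j ≟ j′ ⌋ ] + (𝟙[ not ⌊ j ≟ j′ ⌋ ] + 0)   ≤⟨ 𝟙+𝟙not+0≤1 ⌊ j ≟ j′ ⌋ ⟩
      1                                             ∎
      where
      open ≤-Reasoning
      𝟙+𝟙not+0≤1 : ∀ g → 𝟙[ g ] + (𝟙[ not g ] + 0) ≤ 1
      𝟙+𝟙not+0≤1 true  = ≤-refl
      𝟙+𝟙not+0≤1 false = ≤-refl
    per-index (suc r) j′ = begin
      𝟙[ ⌊ j ≟ j′ ⌋ ] + count {#pendant} (λ _ → false)
        ≡⟨ cong (𝟙[ ⌊ j ≟ j′ ⌋ ] +_) (count-false {#pendant} {λ _ → false} (λ _ → refl)) ⟩
      𝟙[ ⌊ j ≟ j′ ⌋ ] + 0                            ≤⟨ 𝟙+0≤1 ⌊ j ≟ j′ ⌋ ⟩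
      1                                              ∎
      where
      open ≤-Reasoning
      𝟙+0≤1 : ∀ g → 𝟙[ g ] + 0 ≤ 1
      𝟙+0≤1 true  = ≤-refl
      𝟙+0≤1 false = z≤n

  Δ₀ : ℕ
  Δ₀ = suc (2 * m) + #pendant

  2m+1≤degV : ∀ w → suc (2 * m) ≤ degV w
  2m+1≤degV (inner t j k b)   = ≤-trans (≤-reflexive (≡.sym (inner-nbrs-inner t j k b))) (m≤m+n _ _)
  2m+1≤degV (outer j zero)    = ≤-trans (≤-reflexive (≡.sym (inner-nbrs-outer₀ j))) (m≤m+n _ _)
  2m+1≤degV (outer j (suc r)) = begin
    suc (2 * m)                   ≤⟨ n≤1+n (suc (2 * m)) ⟩
    suc (suc (2 * m))             ≡⟨ *-suc 2 m ⟨
    2 * c                         ≡⟨ inner-nbrs-outer₊ j r ⟨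
    inner-nbrs (outer j (suc r))  ≤⟨ m≤m+n _ _ ⟩
    degV (outer j (suc r))        ∎
    where open ≤-Reasoning

  degV≤Δ₀ : ∀ w → degV w ≤ Δ₀
  degV≤Δ₀ (inner zero j k b) =
    +-mono-≤ (≤-reflexive (inner-nbrs-inner zero j k b))
             (≤-trans (≤-reflexive (outer-nbrs-inner₀ j k b)) (𝟙≤ (not (⌊ k ≟ j ⌋ ∧ ⌊ b ≟ zero ⌋))))
    where
    𝟙≤ : ∀ g → 𝟙[ g ] ≤ #pendant
    𝟙≤ true  = s≤s z≤n
    𝟙≤ false = z≤n
  degV≤Δ₀ (inner (suc zero) j k b) =
    ≤-reflexive (cong₂ _+_ (inner-nbrs-inner (suc zero) j k b) (outer-nbrs-inner₁ j k b))
  degV≤Δ₀ (outer j zero)           = ≤-reflexive (cong₂ _+_ (inner-nbrs-outer₀ j) (outer-nbrs-outer₀ j))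
  degV≤Δ₀ (outer j (suc r))        = begin
    inner-nbrs (outer j (suc r)) + outer-nbrs (outer j (suc r))
      ≤⟨ +-mono-≤ (≤-reflexive (inner-nbrs-outer₊ j r)) (outer-nbrs-outer₊ j r) ⟩
    2 * c + c                  ≤⟨ m≤m+n (2 * c + c) m ⟩
    2 * suc m + suc m + m      ≡⟨ solve (m ∷ []) ⟩
    suc (2 * m) + (2 + 2 * m)  ∎
    where open ≤-Reasoning

  G-min-degree : MinDegree G (suc (2 * m))
  G-min-degree = (λ x → ≤-trans (2m+1≤degV (decode x)) (≤-reflexive (≡.sym (deg≡degV x))))
               , encode (inner zero zero zero zero)
               , ≡.trans (deg-encode (inner zero zero zero zero))
                         (≡.trans (cong₂ _+_ (inner-nbrs-inner zero zero zero zero) (outer-nbrs-inner₀ zero zero zero))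
                                  (+-identityʳ _))

  G-max-degree : MaxDegree G Δ₀
  G-max-degree = (λ x → ≤-trans (≤-reflexive (deg≡degV x)) (degV≤Δ₀ (decode x)))
               , encode (outer zero zero)
               , ≡.trans (deg-encode (outer zero zero)) (cong₂ _+_ (inner-nbrs-outer₀ zero) (outer-nbrs-outer₀ zero))

  K : ℕ
  K = c + c * p

  classA : Fin c → Fin K
  classA k = k ↑ˡ (c * p)

  classO : Fin c → Fin p → Fin K
  classO j r = c ↑ʳ combine j r

  class : Vtx → Fin K
  class (inner _ _ k _) = classA k
  class (outer j r)     = classO j r

  classA≢classO : ∀ k j r → classA k ≢ classO j r
  classA≢classO k j r eq
    with () ← ≡.trans (≡.sym (splitAt-↑ˡ c k (c * p)))
                      (≡.trans (cong (splitAt c) eq) (splitAt-↑ʳ c (c * p) (combine j r)))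

  Ω : Partition G K
  Ω = record { label = class ∘ decode ; nonempty = inhabited }
    where
    inhabited : ∀ i → ∃ λ x → class (decode x) ≡ i
    inhabited i with splitAt c i in split-i
    ... | inj₁ k = encode w , ≡.trans (cong class (decode-encode w)) (splitAt⁻¹-↑ˡ split-i)
      where w = inner zero zero k zero
    ... | inj₂ y = encode w , ≡.trans (cong class (decode-encode w))
                                      (≡.trans (cong (c ↑ʳ_) (combine-remQuot {c} p y)) (splitAt⁻¹-↑ʳ split-i))
      where w = uncurry outer (remQuot {c} p y)

  encode-injective : ∀ {w w′} → encode w ≡ encode w′ → w ≡ w′
  encode-injective {w} {w′} eq = ≡.trans (≡.sym (decode-encode w)) (≡.trans (cong decode eq) (decode-encode w′))

  part-encode : ∀ i w → part Ω i (encode w) ≡ ⌊ class w ≟ i ⌋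
  part-encode i w = cong (λ v → ⌊ class v ≟ i ⌋) (decode-encode w)

  closed-self : ∀ z {w} → decode z ≡ w → closedNbr G z (encode w) ≡ true
  closed-self z refl rewrite encode-decode z | ≟-refl z = refl

  closed-adj : ∀ z {w₀} w → decode z ≡ w₀ → adjV w₀ w ≡ true → closedNbr G z (encode w) ≡ true
  closed-adj z w refl w₀~w = ∨-introʳ ⌊ encode w ≟ z ⌋ (≡.trans (cong (adjV (decode z)) (decode-encode w)) w₀~w)

  closed-clique : ∀ z {t j k b} k′ b′ → decode z ≡ inner t j k b → closedNbr G z (encode (inner t j k′ b′)) ≡ true
  closed-clique z {t} {j} {k} {b} k′ b′ dz with ⌊ k ≟ k′ ⌋ ∧ ⌊ b ≟ b′ ⌋ in same
  ... | true  = closed-self z (≡.trans dz (cong₂ (inner t j) (≟-true (∧-conicalˡ ⌊ k ≟ k′ ⌋ _ same))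
                                                            (≟-true (∧-conicalʳ ⌊ k ≟ k′ ⌋ _ same))))
  ... | false = closed-adj z (inner t j k′ b′) dz adjacent-in-clique
    where
    adjacent-in-clique : adjV (inner t j k b) (inner t j k′ b′) ≡ true
    adjacent-in-clique rewrite ≟-refl t | ≟-refl j | same = refl

  2≤nbrCount : ∀ (S : VSet G) z w₁ w₂ → w₁ ≢ w₂ →
    closedNbr G z (encode w₁) ≡ true → S (encode w₁) ≡ true →
    closedNbr G z (encode w₂) ≡ true → S (encode w₂) ≡ true → 2 ≤ nbrCount G S z
  2≤nbrCount S z w₁ w₂ w₁≢w₂ z~w₁ w₁∈S z~w₂ w₂∈S =
    count-≥2 (λ u → closedNbr G z u ∧ S u) (cong₂ _∧_ z~w₁ w₁∈S) (cong₂ _∧_ z~w₂ w₂∈S) (w₁≢w₂ ∘ encode-injective)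

  A∪O-dominating : ∀ j r → IsDoubleDominating G (_∪_ {G} (part Ω (classA j)) (part Ω (classO j r)))
  A∪O-dominating j r z = covers (decode z) refl
    where
    U : VSet G
    U = _∪_ {G} (part Ω (classA j)) (part Ω (classO j r))
    inA : ∀ t j′ b → U (encode (inner t j′ j b)) ≡ true
    inA t j′ b = ∨-introˡ (part Ω (classO j r) (encode (inner t j′ j b)))
                          (≡.trans (part-encode (classA j) (inner t j′ j b)) (≟-refl (classA j)))
    inO : U (encode (outer j r)) ≡ true
    inO = ∨-introʳ (part Ω (classA j) (encode (outer j r)))
                   (≡.trans (part-encode (classO j r) (outer j r)) (≟-refl (classO j r)))
    covers : ∀ w → decode z ≡ w → 2 ≤ nbrCount G U z
    covers (inner t j′ k b) dz =
      2≤nbrCount U z (inner t j′ j zero) (inner t j′ j (suc zero)) (λ ())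
        (closed-clique z j zero dz) (inA t j′ zero) (closed-clique z j (suc zero) dz) (inA t j′ (suc zero))
    covers (outer j′ (suc r′)) dz =
      2≤nbrCount U z (inner (suc zero) j′ j zero) (inner (suc zero) j′ j (suc zero)) (λ ())
        (closed-adj z (inner (suc zero) j′ j zero) dz (≟-refl j′)) (inA (suc zero) j′ zero)
        (closed-adj z (inner (suc zero) j′ j (suc zero)) dz (≟-refl j′)) (inA (suc zero) j′ (suc zero))
    covers (outer j′ zero) dz with j′ ≟ j
    ... | no j′≢j =
      2≤nbrCount U z (inner zero j′ j zero) (inner zero j′ j (suc zero)) (λ ())
        (closed-adj z (inner zero j′ j zero) dz (apex-sees zero)) (inA zero j′ zero)
        (closed-adj z (inner zero j′ j (suc zero)) dz (apex-sees (suc zero))) (inA zero j′ (suc zero))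
      where
      apex-sees : ∀ b → adjV (outer j′ zero) (inner zero j′ j b) ≡ true
      apex-sees b rewrite ≟-refl j′ | ≟-≢ (j′≢j ∘ ≡.sym) = refl
    ... | yes refl =
      2≤nbrCount U z (inner zero j j (suc zero)) (outer j r) (λ ())
        (closed-adj z (inner zero j j (suc zero)) dz apex-sees) (inA zero j (suc zero)) (apex-closed r) inO
      where
      apex-sees : adjV (outer j zero) (inner zero j j (suc zero)) ≡ true
      apex-sees rewrite ≟-refl j = refl
      apex-closed : ∀ r → closedNbr G z (encode (outer j r)) ≡ true
      apex-closed zero    = closed-self z dz
      apex-closed (suc r) = closed-adj z (outer j (suc r)) dz (≟-refl j)

  class-outer : ∀ w {j r} → class w ≡ classO j r → w ≡ outer j r
  class-outer (inner _ _ k _) {j} {r} eq = ⊥-elim (classA≢classO k j r eq)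
  class-outer (outer j′ r′) {j} {r} eq with refl , refl ← combine-injective j′ r′ j r (↑ʳ-injective c _ _ eq) = refl

  class-inner : ∀ w {k} → class w ≡ classA k → ∃ λ t → ∃ λ j → ∃ λ b → w ≡ inner t j k b
  class-inner (inner t j k′ b) {k} eq with refl ← ↑ˡ-injective (c * p) k′ k eq = t , j , b , refl
  class-inner (outer j r) {k} eq = ⊥-elim (classA≢classO k j r (≡.sym eq))

  O-not-dominating : ∀ j r → ¬ IsDoubleDominating G (part Ω (classO j r))
  O-not-dominating j r = not-double-dominating G _ z λ x y x∈ y∈ →
    ≡.trans (≡.sym (is-member x x∈)) (is-member y y∈)
    where
    z = encode (outer j r)
    is-member : ∀ x → closedNbr G z x ∧ part Ω (classO j r) x ≡ true → z ≡ x
    is-member x x∈ =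
      ≡.trans (cong encode (≡.sym (class-outer (decode x) {j} {r} (≟-true (∧-conicalʳ (closedNbr G z x) _ x∈)))))
              (encode-decode x)

  apex-sees-one : ∀ {t j k b} → adjV (outer k zero) (inner t j k b) ≡ true → inner t j k b ≡ inner zero k k (suc zero)
  apex-sees-one {zero} {j} {k} {b} apex~ with j ≟ k | b
  ... | yes refl | suc zero = refl
  ... | yes refl | zero     rewrite ≟-refl j with () ← apex~
  ... | no _     | _        with () ← apex~
  apex-sees-one {suc zero} ()

  A-not-dominating : ∀ k → ¬ IsDoubleDominating G (part Ω (classA k))
  A-not-dominating k = not-double-dominating G _ z λ x y x∈ y∈ →
    ≡.trans (≡.sym (is-twin x x∈)) (is-twin y y∈)
    where
    z = encode (outer k zero)
    is-twin : ∀ x → closedNbr G z x ∧ part Ω (classA k) x ≡ true → encode (inner zero k k (suc zero)) ≡ x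
    is-twin x x∈ with t , j , b , dx ← class-inner (decode x) (≟-true (∧-conicalʳ (closedNbr G z x) _ x∈))
                 with closedNbr-cases G {z} {x} (∧-conicalˡ (closedNbr G z x) _ x∈)
    ... | inj₁ refl with () ← ≡.trans (≡.sym (decode-encode (outer k zero))) dx
    ... | inj₂ z~x = ≡.trans (cong encode (≡.sym (≡.trans dx (apex-sees-one apex~x)))) (encode-decode x)
      where
      apex~x : adjV (outer k zero) (inner t j k b) ≡ true
      apex~x = subst₂ (λ w w′ → adjV w w′ ≡ true) (decode-encode (outer k zero)) dx z~x

  A-O-coalition : ∀ j r → IsDoubleCoalition G (part Ω (classA j)) (part Ω (classO j r))
  A-O-coalition j r =
    part-disjoint G Ω (classA≢classO j j r) , A-not-dominating j , O-not-dominating j r , A∪O-dominating j r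

  Partnered : Fin K → Set
  Partnered i = ∃ λ i′ → i ≢ i′ × IsDoubleCoalition G (part Ω i) (part Ω i′)

  coalitions : IsDoubleCoalitionPartition G K Ω
  coalitions i with splitAt c i in split-i
  ... | inj₁ k =
    subst Partnered (splitAt⁻¹-↑ˡ split-i) (classO k zero , classA≢classO k k zero , A-O-coalition k zero)
  ... | inj₂ y with j , r ← remQuot {c} p y in jr =
    subst Partnered i≡classO (classA j , classA≢classO j j r ∘ ≡.sym , O-A-coalition)
    where
    i≡classO : classO j r ≡ i
    i≡classO = ≡.trans (cong (c ↑ʳ_) (≡.trans (cong (uncurry combine) (≡.sym jr)) (combine-remQuot {c} p y)))
                       (splitAt⁻¹-↑ʳ split-i)
    O-A-coalition : IsDoubleCoalition G (part Ω (classO j r)) (part Ω (classA j))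
    O-A-coalition = coalition-sym G {part Ω (classA j)} {part Ω (classO j r)} (A-O-coalition j r)

  K≡dcBound : K ≡ dcBound (suc (2 * m)) Δ₀
  K≡dcBound = ≡.sym (begin
    dcBound (suc (2 * m)) Δ₀
      ≡⟨ cong₂ (λ a h → a * (Δ₀ + 2 ∸ 2 * a) + 1 + h) (cong suc (⌊2*n/2⌋≡n m)) (⌈2*n/2⌉≡n m) ⟩
    suc m * (Δ₀ + 2 ∸ 2 * suc m) + 1 + m
      ≡⟨ cong (λ x → suc m * (x ∸ 2 * suc m) + 1 + m) Δ₀+2≡ ⟩
    suc m * (2 * suc m + (3 + 2 * m) ∸ 2 * suc m) + 1 + m
      ≡⟨ cong (λ x → suc m * x + 1 + m) (m+n∸m≡n (2 * suc m) (3 + 2 * m)) ⟩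
    suc m * (3 + 2 * m) + 1 + m    ≡⟨ solve (m ∷ []) ⟩
    suc m + suc m * (3 + 2 * m)    ∎)
    where
    open ≡-Reasoning
    Δ₀+2≡ : suc (2 * m) + (2 + 2 * m) + 2 ≡ 2 * suc m + (3 + 2 * m)
    Δ₀+2≡ = solve (m ∷ [])

  4⌈δ/2⌉∸3≤Δ₀ : 4 * ⌈ suc (2 * m) /2⌉ ∸ 3 ≤ Δ₀
  4⌈δ/2⌉∸3≤Δ₀ = begin
    4 * suc ⌊ 2 * m /2⌋ ∸ 3     ≡⟨ cong (λ x → 4 * suc x ∸ 3) (⌊2*n/2⌋≡n m) ⟩
    4 * suc m ∸ 3               ≤⟨ ∸-monoˡ-≤ 3 (m≤m+n (4 * suc m) 2) ⟩
    4 * suc m + 2 ∸ 3           ≡⟨ cong (_∸ 3) 4[1+m]+2≡Δ₀+3 ⟩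
    suc (2 * m) + (2 + 2 * m) + 3 ∸ 3   ≡⟨ m+n∸n≡m Δ₀ 3 ⟩
    Δ₀                          ∎
    where
    open ≤-Reasoning
    4[1+m]+2≡Δ₀+3 : 4 * suc m + 2 ≡ suc (2 * m) + (2 + 2 * m) + 3
    4[1+m]+2≡Δ₀+3 = solve (m ∷ [])

Attains : ℕ → Set
Attains δ = Σ Graph λ G → ∃ λ Δ → MinDegree G δ × MaxDegree G Δ
              × 4 * ⌈ δ /2⌉ ∸ 3 ≤ Δ × IsDCNumber G (dcBound δ Δ)

construction-attains : ∀ m → Attains (suc (2 * m))
construction-attains m =
  G , Δ₀ , G-min-degree , G-max-degree , 4⌈δ/2⌉∸3≤Δ₀ ,
  subst (HasDCPartition G) K≡dcBound (Ω , coalitions) ,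
  λ k → dc-upper-bound G (suc (2 * m)) Δ₀ G-min-degree G-max-degree 4⌈δ/2⌉∸3≤Δ₀ k
  where open Construction m

theorem4p1 : ((G : Graph) (δ Δ : ℕ) → MinDegree G δ → MaxDegree G Δ → 1 ≤ δ
    → 4 * ⌈ δ /2⌉ ∸ 3 ≤ Δ
    → ∀ k → HasDCPartition G k → k ≤ dcBound δ Δ)
    × ((δ : ℕ) → 3 ≤ δ → ¬ (2 ∣ δ)
    → Σ Graph λ G → ∃ λ Δ → MinDegree G δ × MaxDegree G Δ
    × 4 * ⌈ δ /2⌉ ∸ 3 ≤ Δ × IsDCNumber G (dcBound δ Δ))
theorem4p1 =
  (λ G δ Δ min-deg max-deg _ → dc-upper-bound G δ Δ min-deg max-deg) ,
  (λ δ _ ¬2∣δ → subst Attains (≡.sym (odd⇒≡1+2⌊n/2⌋ δ ¬2∣δ)) (construction-attains ⌊ δ /2⌋))
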